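{- Let $(M,w,T,k)$ be an instance of \textsc{Space Cover} where $M$ is a regular matroid, and suppose there is a circuit $C$ of $M$ with $C\subseteq T$. Let $e\in C$. Then $(M,w,T,k)$ is a yes-instance if and only if $(M-e,w',T\setminus\{e\},k)$ is a yes-instance, where $M-e$ is obtained by deleting $e$ and $w'$ is the restriction of $w$ to $E\setminus\{e\}$.
   Context: \textsc{Space Cover}: given a binary matroid $M$ on $E$ (with a $\mathrm{GF}(2)$ representation), $w\colon E\to\mathbb{N}_0$, $T\subseteq E$ and a nonnegative integer $k$, decide whether there is $F\subseteq E\setminus T$ with $w(F)\le k$ and $T\subseteq\mathrm{span}(F)$, where $F$ spans $e$ if $r(F\cup\{e\})=r(F)$. A matroid is regular if it is representable over every field. -}

module Defs where

open import Level using (Level; _⊔_; Setω) renaming (suc to lsuc)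
open import Data.Nat using (ℕ; zero; suc; _≤_) renaming (_+_ to _+ℕ_)
open import Data.Bool using (Bool; true; false; _∧_; _xor_; if_then_else_)
open import Data.Fin using (Fin; zero; suc; punchIn)
open import Data.Fin.Subset using (Subset; _∈_; _⊆_; _⊂_; _∪_; ⁅_⁆; ∣_∣; ∁; Nonempty)
open import Data.Vec using (lookup; tabulate)
open import Data.Product using (Σ; ∃; _×_)
open import Relation.Nullary using (¬_)
open import Relation.Binary.PropositionalEquality using (_≡_)
open import Algebra.Bundles using (CommutativeRing)

record Field (c ℓ : Level) : Set (lsuc (c ⊔ ℓ)) where
  field
    commutativeRing : CommutativeRing c ℓ
  open CommutativeRing commutativeRing public
  field
    1≉0     : ¬ (1# ≈ 0#)
    inverse : ∀ x → ¬ (x ≈ 0#) → Σ Carrier (λ y → (x * y) ≈ 1#)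

⊕Σ : ∀ {n} → (Fin n → Bool) → Bool
⊕Σ {zero}  f = false
⊕Σ {suc n} f = f zero xor ⊕Σ (λ i → f (suc i))

ℕΣ : ∀ {n} → (Fin n → ℕ) → ℕ
ℕΣ {zero}  f = 0
ℕΣ {suc n} f = f zero +ℕ ℕΣ (λ i → f (suc i))

-- Binary matroids given by a GF(2) representation.
-- A representation is an m × n matrix over GF(2) = Bool (xor, ∧);
-- the ground set is E = Fin n, element j being column j.

BinRep : ℕ → ℕ → Set
BinRep m n = Fin m → Fin n → Bool

ColumnsSumZero : ∀ {m n} → BinRep m n → Subset n → Set
ColumnsSumZero A Y = ∀ r → ⊕Σ (λ j → lookup Y j ∧ A r j) ≡ false

-- X is independent iff its columns are linearly independent over GF(2),
-- i.e. no nontrivial GF(2)-combination (= nonempty subset) of them is 0.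
Independent : ∀ {m n} → BinRep m n → Subset n → Set
Independent A X = ∀ Y → Y ⊆ X → Nonempty Y → ¬ ColumnsSumZero A Y

Circuit : ∀ {m n} → BinRep m n → Subset n → Set
Circuit A C = ¬ Independent A C × (∀ Y → Y ⊂ C → Independent A Y)

HasRank : ∀ {m n} → BinRep m n → Subset n → ℕ → Set
HasRank A X ρ = (∃ λ I → I ⊆ X × Independent A I × ∣ I ∣ ≡ ρ)
              × (∀ I → I ⊆ X → Independent A I → ∣ I ∣ ≤ ρ)

Spans : ∀ {m n} → BinRep m n → Subset n → Fin n → Set
Spans A F e = ∃ λ ρ → HasRank A F ρ × HasRank A (F ∪ ⁅ e ⁆) ρ

SpansAll : ∀ {m n} → BinRep m n → Subset n → Subset n → Set
SpansAll A F T = ∀ {t} → t ∈ T → Spans A F t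

weight : ∀ {n} → (Fin n → ℕ) → Subset n → ℕ
weight w F = ℕΣ (λ i → if lookup F i then w i else 0)

SpaceCoverYes : ∀ {m n} → BinRep m n → (Fin n → ℕ) → Subset n → ℕ → Set
SpaceCoverYes A w T k =
  ∃ λ F → F ⊆ ∁ T × weight w F ≤ k × SpansAll A F T

LinIndep : ∀ {c ℓ} (𝔽 : Field c ℓ) {m n} →
           (Fin m → Fin n → Field.Carrier 𝔽) → Subset n → Set (c ⊔ ℓ)
LinIndep 𝔽 {m} {n} B X =
  ∀ (coef : Fin n → Carrier) →
  (∀ r → sum (λ j → if lookup X j then coef j * B r j else 0#) ≈ 0#) →
  ∀ {j} → j ∈ X → coef j ≈ 0#
  where
  open Field 𝔽 using (Carrier; _≈_; _+_; _*_; 0#)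
  sum : ∀ {k} → (Fin k → Carrier) → Carrier
  sum {zero}  f = 0#
  sum {suc k} f = f zero + sum (λ i → f (suc i))

RepresentableOver : ∀ {c ℓ} → Field c ℓ → ∀ {m n} → BinRep m n → Set (c ⊔ ℓ)
RepresentableOver 𝔽 {m} {n} A =
  Σ ℕ λ m′ → Σ (Fin m′ → Fin n → Field.Carrier 𝔽) λ B →
    ∀ X → (Independent A X → LinIndep 𝔽 B X) × (LinIndep 𝔽 B X → Independent A X)

Regular : ∀ {m n} → BinRep m n → Setω
Regular A = ∀ {c ℓ} (𝔽 : Field c ℓ) → RepresentableOver 𝔽 A

-- Deletion M - e: ground set E ∖ {e} ≅ Fin n via punchIn e.

delete : ∀ {m n} → BinRep m (suc n) → Fin (suc n) → BinRep m n
delete A e r j = A r (punchIn e j)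

restrictW : ∀ {n} → (Fin (suc n) → ℕ) → Fin (suc n) → (Fin n → ℕ)
restrictW w e j = w (punchIn e j)

removeElt : ∀ {n} → Subset (suc n) → Fin (suc n) → Subset n
removeElt T e = tabulate (λ j → lookup T (punchIn e j))

module Submission where

-- Over GF(2), F spans t (r(F ∪ {t}) = r(F)) exactly when column t is the
-- sum of the columns of some Y ⊆ F, i.e. t is "generated" by F.  A
-- solution F ⊆ E ∖ T avoids e ∈ C ⊆ T, and along E ∖ {e} ≅ Fin n its
-- weight and the columns it generates other than e are unchanged by
-- deleting e; column e itself is generated by C ∖ {e} because C is a
-- circuit, hence by any F generating T ∖ {e}.

open import Defs
open import Data.Nat using (ℕ; suc)
open import Data.Fin using (Fin)
open import Data.Fin.Subset using (Subset; _∈_; _⊆_)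
open import Function.Bundles using (_⇔_)

open import Algebra.Bundles using (CommutativeMonoid; CommutativeRing)
open import Data.Bool using (Bool; true; false; _∧_; _xor_; if_then_else_)
open import Data.Bool.Properties
  using (xor-∧-commutativeRing; ∧-distribʳ-xor; xor-same; xor-identityʳ; ∨-zeroʳ; ∨-identityʳ)
  renaming (_≟_ to _≟ᵇ_)
open import Data.Empty using (⊥-elim)
open import Data.Fin using (zero; suc; punchIn; punchOut)
open import Data.Fin.Properties using (punchInᵢ≢i; punchIn-punchOut; any?; all?)
  renaming (_≟_ to _≟ᶠ_)
open import Data.Fin.Subset using (_∉_; _∪_; ⁅_⁆; ∣_∣; ∁; Nonempty) renaming (⊥ to ∅)
open import Data.Fin.Subset.Properties
  using (_∈?_; _⊆?_; nonempty?; anySubset?; ∉⊥; ⊆-min; ∣p∣≤n; ∪-identityʳ; x∈∁p⇒x∉p; x∉p⇒x∈∁p)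
open import Data.Nat using (zero; _+_; _≤_; _<_)
open import Data.Nat.Properties
  using (+-0-commutativeMonoid; ≤∧≢⇒<; n≮0; m<1+n⇒m≤n; n≮n)
  renaming (_≟_ to _≟ⁿ_)
open import Data.Product using (∃; _×_; _,_; proj₁; proj₂)
open import Data.Product.Function.NonDependent.Propositional using (_×-⇔_)
open import Data.Sum using (_⊎_; inj₁; inj₂)
open import Data.Vec using ([]; _∷_; lookup; zipWith; insertAt; _[_]≔_)
open import Data.Vec.Properties
  using (lookup∘tabulate; tabulate∘lookup; tabulate-cong; lookup-zipWith; lookup∘update; lookup∘update′;
         insertAt-lookup; insertAt-punchIn; []=⇒lookup; lookup⇒[]=)
open import Function using (_∘_)
open import Function.Bundles using (mk⇔; Equivalence)
open import Function.Properties.Equivalence using () renaming (trans to ⇔-trans; sym to ⇔-sym)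
open import Relation.Binary.PropositionalEquality
  using (_≡_; _≢_; refl; sym; trans; cong; cong₂; subst; module ≡-Reasoning)
open import Relation.Nullary using (¬_; Dec; yes; no; ¬?)
open import Relation.Nullary.Decidable using (_×-dec_) renaming (map to Dec-map)
open import Relation.Unary using (Decidable)

record AddsElement {n} (p : Subset n) (x : Fin n) (q : Subset n) : Set where
  field
    new       : lookup p x ≡ false
    added     : lookup q x ≡ true
    elsewhere : ∀ j → j ≢ x → lookup p j ≡ lookup q j

add remove : ∀ {n} → Fin n → Subset n → Subset n
add    x p = p [ x ]≔ true
remove x p = p [ x ]≔ false

∉⇒false : ∀ {n} {x : Fin n} {p : Subset n} → x ∉ p → lookup p x ≡ false
∉⇒false {x = x} {p} x∉p with lookup p x in px
... | true  = ⊥-elim (x∉p (lookup⇒[]= x p px))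
... | false = refl

lookup-elsewhere : ∀ {n} (p : Subset n) {x j} b → j ≢ x → lookup (p [ x ]≔ b) j ≡ lookup p j
lookup-elsewhere p b j≢x = lookup∘update′ j≢x p b

adds-add : ∀ {n} {x : Fin n} {p} → x ∉ p → AddsElement p x (add x p)
adds-add {x = x} {p} x∉p = record
  { new = ∉⇒false x∉p ; added = lookup∘update x p true
  ; elsewhere = λ j j≢x → sym (lookup-elsewhere p true j≢x) }

adds-remove : ∀ {n} {x : Fin n} {p} → x ∈ p → AddsElement (remove x p) x p
adds-remove {x = x} {p} x∈p = record
  { new = lookup∘update x p false ; added = []=⇒lookup x∈p
  ; elsewhere = λ j j≢x → lookup-elsewhere p false j≢x }

∈-update⁻ : ∀ {n} {p : Subset n} {x j b} → j ∈ p [ x ]≔ b → j ≢ x → j ∈ p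
∈-update⁻ {p = p} {j = j} {b} j∈ j≢x =
  lookup⇒[]= j p (trans (sym (lookup-elsewhere p b j≢x)) ([]=⇒lookup j∈))

∈-update⁺ : ∀ {n} {p : Subset n} {x j} b → j ∈ p → j ≢ x → j ∈ p [ x ]≔ b
∈-update⁺ {p = p} {x} {j} b j∈ j≢x =
  lookup⇒[]= j (p [ x ]≔ b) (trans (lookup-elsewhere p b j≢x) ([]=⇒lookup j∈))

x∈add : ∀ {n} {x : Fin n} {p} → x ∈ add x p
x∈add {x = x} {p} = lookup⇒[]= x (add x p) (lookup∘update x p true)

x∉remove : ∀ {n} {x : Fin n} {p} → x ∉ remove x p
x∉remove {x = x} {p} x∈ with trans (sym ([]=⇒lookup x∈)) (lookup∘update x p false)
... | ()

⊆-add : ∀ {n} {x : Fin n} {p} → p ⊆ add x p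
⊆-add {x = x} {p} {j} j∈p with j ≟ᶠ x
... | yes refl = x∈add
... | no  j≢x  = ∈-update⁺ true j∈p j≢x

remove-⊆ : ∀ {n} {x : Fin n} {p} → remove x p ⊆ p
remove-⊆ {x = x} {p} {j} j∈ with j ≟ᶠ x
... | yes refl = ⊥-elim (x∉remove j∈)
... | no  j≢x  = ∈-update⁻ j∈ j≢x

add-⊆ : ∀ {n} {x : Fin n} {p r} → x ∈ r → p ⊆ r → add x p ⊆ r
add-⊆ {x = x} {p} {r} x∈r p⊆r {j} j∈ with j ≟ᶠ x
... | yes refl = x∈r
... | no  j≢x  = p⊆r (∈-update⁻ j∈ j≢x)

add-mono : ∀ {n} {x : Fin n} {p r} → p ⊆ r → add x p ⊆ add x r
add-mono p⊆r = add-⊆ x∈add (⊆-add ∘ p⊆r)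

⊆-add⁻ : ∀ {n} {x : Fin n} {p r} → p ⊆ add x r → x ∉ p → p ⊆ r
⊆-add⁻ p⊆ x∉p j∈ = ∈-update⁻ (p⊆ j∈) λ { refl → x∉p j∈ }

remove-mono : ∀ {n} {x : Fin n} {p r} → p ⊆ r → remove x p ⊆ remove x r
remove-mono p⊆r j∈ = ∈-update⁺ false (p⊆r (remove-⊆ j∈)) λ { refl → x∉remove j∈ }

remove-⊆-add : ∀ {n} {x : Fin n} {p r} → p ⊆ add x r → remove x p ⊆ r
remove-⊆-add p⊆ = ⊆-add⁻ (p⊆ ∘ remove-⊆) x∉remove

∪⁅⁆≡add : ∀ {n} (p : Subset n) x → p ∪ ⁅ x ⁆ ≡ add x p
∪⁅⁆≡add (b ∷ p) zero    = cong₂ _∷_ (∨-zeroʳ b) (∪-identityʳ p)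
∪⁅⁆≡add (b ∷ p) (suc x) = cong₂ _∷_ (∨-identityʳ b) (∪⁅⁆≡add p x)

module IndicatorSum {c ℓ} (M : CommutativeMonoid c ℓ) where
  open CommutativeMonoid M renaming (refl to ≈-refl; sym to ≈-sym; trans to ≈-trans)
  open import Algebra.Properties.CommutativeMonoid.Sum M public using (sum; sum-cong-≗)
  open import Algebra.Properties.CommutativeMonoid.Sum M using (sum-remove)
  open import Relation.Binary.Reasoning.Setoid setoid

  Σ∈ : ∀ {n} → Subset n → (Fin n → Carrier) → Carrier
  Σ∈ p g = sum (λ i → if lookup p i then g i else ε)

  Σ∈-cong : ∀ {n} (p q : Subset n) (g : Fin n → Carrier) →
            (∀ i → lookup p i ≡ lookup q i) → Σ∈ p g ≡ Σ∈ q g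
  Σ∈-cong p q g p≗q = sum-cong-≗ (λ i → cong (if_then g i else ε) (p≗q i))

  Σ∈-∅ : ∀ {n} (g : Fin n → Carrier) → Σ∈ ∅ g ≈ ε
  Σ∈-∅ {zero}  g = ≈-refl
  Σ∈-∅ {suc n} g = ≈-trans (identityˡ _) (Σ∈-∅ (g ∘ suc))

  Σ∈-split : ∀ {n} (p : Subset (suc n)) (g : Fin (suc n) → Carrier) x →
             Σ∈ p g ≈ (if lookup p x then g x else ε) ∙ Σ∈ (removeElt p x) (g ∘ punchIn x)
  Σ∈-split p g x = ≈-trans (sum-remove {i = x} (λ i → if lookup p i then g i else ε))
    (∙-congˡ (reflexive (sum-cong-≗ λ j →
      cong (if_then g (punchIn x j) else ε) (sym (lookup∘tabulate (lookup p ∘ punchIn x) j)))))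

  Σ∈-avoiding : ∀ {n} {p : Subset (suc n)} (g : Fin (suc n) → Carrier) {x} →
                lookup p x ≡ false → Σ∈ p g ≈ Σ∈ (removeElt p x) (g ∘ punchIn x)
  Σ∈-avoiding {p = p} g {x} px = begin
    Σ∈ p g                                                            ≈⟨ Σ∈-split p g x ⟩
    (if lookup p x then g x else ε) ∙ Σ∈ (removeElt p x) (g ∘ punchIn x)
      ≡⟨ cong (λ b → (if b then g x else ε) ∙ Σ∈ (removeElt p x) (g ∘ punchIn x)) px ⟩
    ε ∙ Σ∈ (removeElt p x) (g ∘ punchIn x)                            ≈⟨ identityˡ _ ⟩
    Σ∈ (removeElt p x) (g ∘ punchIn x)                                ∎

  Σ∈-adds : ∀ {n} {p q : Subset n} {x} (g : Fin n → Carrier) →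
            AddsElement p x q → Σ∈ q g ≈ g x ∙ Σ∈ p g
  Σ∈-adds {zero} {x = ()}
  Σ∈-adds {suc n} {p} {q} {x} g adds = begin
    Σ∈ q g                                                   ≈⟨ Σ∈-split q g x ⟩
    (if lookup q x then g x else ε) ∙ Σ∈ (removeElt q x) g′  ≡⟨ cong₂ _∙_ (cong (if_then g x else ε) added) rest ⟩
    g x ∙ Σ∈ (removeElt p x) g′                             ≈⟨ ∙-congˡ (≈-sym (Σ∈-avoiding {p = p} g new)) ⟩
    g x ∙ Σ∈ p g                                             ∎
    where
    open AddsElement adds
    g′ = g ∘ punchIn x
    rest : Σ∈ (removeElt q x) g′ ≡ Σ∈ (removeElt p x) g′
    rest = Σ∈-cong (removeElt q x) (removeElt p x) g′ λ j →
      trans (lookup∘tabulate _ j) (trans (sym (elsewhere _ (punchInᵢ≢i x j))) (sym (lookup∘tabulate _ j)))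

xor-commutativeMonoid : CommutativeMonoid _ _
xor-commutativeMonoid = CommutativeRing.+-commutativeMonoid xor-∧-commutativeRing

module XorSum = IndicatorSum xor-commutativeMonoid
module NatSum = IndicatorSum +-0-commutativeMonoid

⊕Σ≡sum : ∀ {n} (f : Fin n → Bool) → ⊕Σ f ≡ XorSum.sum f
⊕Σ≡sum {zero}  f = refl
⊕Σ≡sum {suc n} f = cong (f zero xor_) (⊕Σ≡sum (f ∘ suc))

ℕΣ≡sum : ∀ {n} (f : Fin n → ℕ) → ℕΣ f ≡ NatSum.sum f
ℕΣ≡sum {zero}  f = refl
ℕΣ≡sum {suc n} f = cong (f zero +_) (ℕΣ≡sum (f ∘ suc))

⊕Σ-cong : ∀ {n} {f g : Fin n → Bool} → (∀ i → f i ≡ g i) → ⊕Σ f ≡ ⊕Σ g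
⊕Σ-cong {f = f} {g} f≗g = trans (⊕Σ≡sum f) (trans (XorSum.sum-cong-≗ f≗g) (sym (⊕Σ≡sum g)))

⊕Σ-xor : ∀ {n} (f g : Fin n → Bool) → ⊕Σ (λ i → f i xor g i) ≡ ⊕Σ f xor ⊕Σ g
⊕Σ-xor f g = trans (⊕Σ≡sum (λ i → f i xor g i))
  (trans (∑-distrib-+ f g) (sym (cong₂ _xor_ (⊕Σ≡sum f) (⊕Σ≡sum g))))
  where open import Algebra.Properties.CommutativeMonoid.Sum xor-commutativeMonoid using (∑-distrib-+)

weight≡Σ∈ : ∀ {n} (w : Fin n → ℕ) F → weight w F ≡ NatSum.Σ∈ F w
weight≡Σ∈ w F = ℕΣ≡sum (λ i → if lookup F i then w i else 0)

∣∣≡Σ∈ : ∀ {n} (p : Subset n) → ∣ p ∣ ≡ NatSum.Σ∈ p (λ _ → 1)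
∣∣≡Σ∈ []          = refl
∣∣≡Σ∈ (true ∷ p)  = cong suc (∣∣≡Σ∈ p)
∣∣≡Σ∈ (false ∷ p) = ∣∣≡Σ∈ p

∣∣-adds : ∀ {n} {p q : Subset n} {x} → AddsElement p x q → ∣ q ∣ ≡ suc ∣ p ∣
∣∣-adds {p = p} {q} adds =
  trans (∣∣≡Σ∈ q) (trans (NatSum.Σ∈-adds (λ _ → 1) adds) (cong suc (sym (∣∣≡Σ∈ p))))

∧-as-if : ∀ b a → b ∧ a ≡ (if b then a else false)
∧-as-if true  a = refl
∧-as-if false a = refl

xor≡false⇒≡ : ∀ a b → a xor b ≡ false → b ≡ a
xor≡false⇒≡ false false _ = refl
xor≡false⇒≡ true  true  _ = refl

xor≡true⇒ : ∀ a b → a xor b ≡ true → a ≡ true ⊎ b ≡ true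
xor≡true⇒ true  _    _ = inj₁ refl
xor≡true⇒ false true _ = inj₂ refl

largest : ∀ {k} {P : Subset k → Set} → Decidable P → ∀ d → (∀ J → P J → ∣ J ∣ ≤ d) → ∃ P →
          ∃ λ I → P I × (∀ J → P J → ∣ J ∣ ≤ ∣ I ∣)
largest {P = P} P? d bounded inhabited with anySubset? (λ J → P? J ×-dec (∣ J ∣ ≟ⁿ d))
... | yes (I , PI , refl) = I , PI , bounded
... | no noneOfSize = search d smaller
  where
  smaller : ∀ J → P J → ∣ J ∣ < d
  smaller J PJ = ≤∧≢⇒< (bounded J PJ) (λ size≡d → noneOfSize (J , PJ , size≡d))
  search : ∀ d′ → (∀ J → P J → ∣ J ∣ < d′) → ∃ λ I → P I × (∀ J → P J → ∣ J ∣ ≤ ∣ I ∣)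
  search zero     below = ⊥-elim (n≮0 (below _ (proj₂ inhabited)))
  search (suc d′) below = largest P? d′ (λ J PJ → m<1+n⇒m≤n (below J PJ)) inhabited

module Span {m n : ℕ} (A : BinRep m n) where

  colSum : Subset n → Fin m → Bool
  colSum Y r = ⊕Σ (λ j → lookup Y j ∧ A r j)

  colSum≡Σ∈ : ∀ Y r → colSum Y r ≡ XorSum.Σ∈ Y (A r)
  colSum≡Σ∈ Y r = trans (⊕Σ≡sum (λ j → lookup Y j ∧ A r j))
                        (XorSum.sum-cong-≗ λ j → ∧-as-if (lookup Y j) (A r j))

  colSum-∅ : ∀ r → colSum ∅ r ≡ false
  colSum-∅ r = trans (colSum≡Σ∈ ∅ r) (XorSum.Σ∈-∅ (A r))

  colSum-adds : ∀ {p q x} → AddsElement p x q → ∀ r → colSum q r ≡ A r x xor colSum p r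
  colSum-adds {p} {q} {x} adds r = trans (colSum≡Σ∈ q r)
    (trans (XorSum.Σ∈-adds (A r) adds) (cong (A r x xor_) (sym (colSum≡Σ∈ p r))))

  _△_ : Subset n → Subset n → Subset n
  Y △ Z = zipWith _xor_ Y Z

  colSum-△ : ∀ Y Z r → colSum (Y △ Z) r ≡ colSum Y r xor colSum Z r
  colSum-△ Y Z r =
    trans (⊕Σ-cong distrib) (⊕Σ-xor (λ j → lookup Y j ∧ A r j) (λ j → lookup Z j ∧ A r j))
    where
    distrib : ∀ j → lookup (Y △ Z) j ∧ A r j ≡ (lookup Y j ∧ A r j) xor (lookup Z j ∧ A r j)
    distrib j = trans (cong (_∧ A r j) (lookup-zipWith _xor_ j Y Z))
                      (∧-distribʳ-xor (A r j) (lookup Y j) (lookup Z j))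

  △-⊆ : ∀ {Y Z F} → Y ⊆ F → Z ⊆ F → Y △ Z ⊆ F
  △-⊆ {Y} {Z} Y⊆F Z⊆F {j} j∈
    with xor≡true⇒ (lookup Y j) (lookup Z j) (trans (sym (lookup-zipWith _xor_ j Y Z)) ([]=⇒lookup j∈))
  ... | inj₁ Yj = Y⊆F (lookup⇒[]= j Y Yj)
  ... | inj₂ Zj = Z⊆F (lookup⇒[]= j Z Zj)

  InSpan : Subset n → (Fin m → Bool) → Set
  InSpan F v = ∃ λ Y → Y ⊆ F × (∀ r → colSum Y r ≡ v r)

  Generated : Subset n → Fin n → Set
  Generated F t = InSpan F (λ r → A r t)

  inSpan-cong : ∀ {F u v} → InSpan F u → (∀ r → u r ≡ v r) → InSpan F v
  inSpan-cong (Y , Y⊆F , sum≡u) u≗v = Y , Y⊆F , λ r → trans (sum≡u r) (u≗v r)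

  inSpan-zero : ∀ {F} → InSpan F (λ _ → false)
  inSpan-zero {F} = ∅ , ⊆-min F , colSum-∅

  inSpan-xor : ∀ {F u v} → InSpan F u → InSpan F v → InSpan F (λ r → u r xor v r)
  inSpan-xor (Y , Y⊆F , Y≗u) (Z , Z⊆F , Z≗v) =
    Y △ Z , △-⊆ Y⊆F Z⊆F , λ r → trans (colSum-△ Y Z r) (cong₂ _xor_ (Y≗u r) (Z≗v r))

  inSpan-⊕Σ : ∀ {F k} (v : Fin k → Fin m → Bool) → (∀ j → InSpan F (v j)) →
              InSpan F (λ r → ⊕Σ (λ j → v j r))
  inSpan-⊕Σ {k = zero}  v spanned = inSpan-zero
  inSpan-⊕Σ {k = suc k} v spanned = inSpan-xor (spanned zero) (inSpan-⊕Σ (v ∘ suc) (spanned ∘ suc))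

  generated-mem : ∀ {F t} → t ∈ F → Generated F t
  generated-mem {F} {t} t∈F = add t ∅ , add-⊆ t∈F (⊆-min F) ,
    λ r → trans (colSum-adds (adds-add ∉⊥) r)
                (trans (cong (A r t xor_) (colSum-∅ r)) (xor-identityʳ (A r t)))

  generated-mono : ∀ {F G t} → Generated F t → F ⊆ G → Generated G t
  generated-mono (Y , Y⊆F , Y≗t) F⊆G = Y , F⊆G ∘ Y⊆F , Y≗t

  generated-trans : ∀ {X F t} → (∀ {j} → j ∈ X → Generated F j) → Generated X t → Generated F t
  generated-trans {X} {F} genX (Y , Y⊆X , Y≗t) =
    inSpan-cong (inSpan-⊕Σ (λ j r → lookup Y j ∧ A r j) term) Y≗t
    where
    term : ∀ j → InSpan F (λ r → lookup Y j ∧ A r j)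
    term j with lookup Y j in Yj
    ... | true  = genX (Y⊆X (lookup⇒[]= j Y Yj))
    ... | false = inSpan-zero

  -- Generation is decidable: there are finitely many candidate Y ⊆ F.
  generated? : ∀ F t → Dec (Generated F t)
  generated? F t = anySubset? λ Y → (Y ⊆? F) ×-dec all? (λ r → colSum Y r ≟ᵇ A r t)

  escape : ∀ {X F t} → Generated X t → ¬ Generated F t → ∃ λ x → x ∈ X × ¬ Generated F x
  escape {X} {F} genX ¬genF with any? (λ x → (x ∈? X) ×-dec ¬? (generated? F x))
  ... | yes escaping = escaping
  ... | no  none     = ⊥-elim (¬genF (generated-trans all-generated genX))
    where
    all-generated : ∀ {x} → x ∈ X → Generated F x
    all-generated {x} x∈X with generated? F x
    ... | yes genx = genx
    ... | no ¬genx = ⊥-elim (none (x , x∈X , ¬genx))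

  Dependency : Subset n → Subset n → Set
  Dependency X Y = Y ⊆ X × Nonempty Y × ColumnsSumZero A Y

  dependency? : ∀ X → Dec (∃ (Dependency X))
  dependency? X = anySubset? λ Y → (Y ⊆? X) ×-dec nonempty? Y ×-dec all? (λ r → colSum Y r ≟ᵇ false)

  independent⇔ : ∀ {X} → (¬ ∃ (Dependency X)) ⇔ Independent A X
  independent⇔ {X} = mk⇔ (λ noDep Y Y⊆X ne sum≡0 → noDep (Y , Y⊆X , ne , sum≡0)) from
    where
    from : Independent A X → ¬ ∃ (Dependency X)
    from ind (Y , Y⊆X , ne , sum≡0) = ind Y Y⊆X ne sum≡0

  independent? : ∀ X → Dec (Independent A X)
  independent? X = Dec-map independent⇔ (¬? (dependency? X))

  dependency : ∀ {X} → ¬ Independent A X → ∃ (Dependency X)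
  dependency {X} dependent with dependency? X
  ... | yes dep   = dep
  ... | no  noDep = ⊥-elim (dependent (Equivalence.to independent⇔ noDep))

  independent-⊆ : ∀ {I J} → Independent A J → I ⊆ J → Independent A I
  independent-⊆ indJ I⊆J Y Y⊆I = indJ Y (I⊆J ∘ Y⊆I)

  ∅-independent : Independent A ∅
  ∅-independent Y Y⊆∅ (j , j∈Y) _ = ∉⊥ (Y⊆∅ j∈Y)

  dependency-generates : ∀ {Y x} → x ∈ Y → ColumnsSumZero A Y → Generated (remove x Y) x
  dependency-generates {Y} {x} x∈Y sum≡0 = remove x Y , (λ j∈ → j∈) ,
    λ r → xor≡false⇒≡ (A r x) _ (trans (sym (colSum-adds (adds-remove x∈Y) r)) (sum≡0 r))

  augment : ∀ {I x} → Independent A I → ¬ Generated I x → Independent A (add x I)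
  augment {I} {x} indI ¬genx Y Y⊆ ne sum≡0 with x ∈? Y
  ... | yes x∈Y = ¬genx (generated-mono (dependency-generates x∈Y sum≡0) (remove-⊆-add Y⊆))
  ... | no  x∉Y = indI Y (⊆-add⁻ Y⊆ x∉Y) ne sum≡0

  not-generated-by-rest : ∀ {J t} → Independent A J → t ∈ J → ¬ Generated (remove t J) t
  not-generated-by-rest {J} {t} indJ t∈J (Z , Z⊆ , Z≗t) =
    indJ (add t Z) (add-⊆ t∈J (remove-⊆ ∘ Z⊆)) (t , x∈add) λ r → begin
      colSum (add t Z) r     ≡⟨ colSum-adds (adds-add t∉Z) r ⟩
      A r t xor colSum Z r   ≡⟨ cong (A r t xor_) (Z≗t r) ⟩
      A r t xor A r t        ≡⟨ xor-same (A r t) ⟩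
      false                  ∎
    where
    open ≡-Reasoning
    t∉Z : t ∉ Z
    t∉Z t∈Z = x∉remove (Z⊆ t∈Z)

  circuit-generated : ∀ {C x} → Circuit A C → x ∈ C → Generated (remove x C) x
  circuit-generated {C} {x} (dependent , minimal) x∈C with dependency dependent
  ... | Y , Y⊆C , ne , sum≡0 with x ∈? Y
  ...   | yes x∈Y = generated-mono (dependency-generates x∈Y sum≡0) (remove-mono Y⊆C)
  ...   | no  x∉Y = ⊥-elim (minimal Y (Y⊆C , x , x∈C , x∉Y) Y (λ j∈ → j∈) ne sum≡0)

  rank : ∀ X → ∃ (HasRank A X)
  rank X with largest (λ J → (J ⊆? X) ×-dec independent? J) n (λ J _ → ∣p∣≤n J)
                      (∅ , ⊆-min X , ∅-independent)
  ... | I , (I⊆X , indI) , maximal =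
    ∣ I ∣ , (I , I⊆X , indI , refl) , λ J J⊆X indJ → maximal J (J⊆X , indJ)

  -- An independent
  -- J ⊆ X ∪ {t} containing t trades t for an element x of X that J ∖ {t}
  -- does not generate (one exists, as J ∖ {t} cannot generate t).
  rank-stable : ∀ {X t ρ} → Generated X t → HasRank A X ρ → HasRank A (add t X) ρ
  rank-stable {X} {t} {ρ} genX ((I , I⊆X , indI , ∣I∣≡ρ) , bounded) =
    (I , ⊆-add ∘ I⊆X , indI , ∣I∣≡ρ) , bounded′
    where
    bounded′ : ∀ J → J ⊆ add t X → Independent A J → ∣ J ∣ ≤ ρ
    bounded′ J J⊆ indJ with t ∈? J
    ... | no  t∉J = bounded J (⊆-add⁻ J⊆ t∉J) indJ
    ... | yes t∈J with escape genX (not-generated-by-rest indJ t∈J)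
    ...   | x , x∈X , ¬genx = subst (_≤ ρ) same-size
            (bounded (add x J₀) (add-⊆ x∈X (remove-⊆-add J⊆))
                     (augment (independent-⊆ indJ remove-⊆) ¬genx))
      where
      J₀ = remove t J
      same-size : ∣ add x J₀ ∣ ≡ ∣ J ∣
      same-size = trans (∣∣-adds (adds-add λ x∈J₀ → ¬genx (generated-mem x∈J₀)))
                        (sym (∣∣-adds (adds-remove t∈J)))

  rank-grows : ∀ {X t ρ} → ¬ Generated X t → HasRank A X ρ → ¬ HasRank A (add t X) ρ
  rank-grows {X} {t} ¬genX ((I , I⊆X , indI , refl) , _) (_ , bounded′) =
    n≮n ∣ I ∣ (subst (_≤ ∣ I ∣) (∣∣-adds (adds-add t∉I))
      (bounded′ (add t I) (add-mono I⊆X) (augment indI ¬genI)))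
    where
    ¬genI : ¬ Generated I t
    ¬genI genI = ¬genX (generated-mono genI I⊆X)
    t∉I : t ∉ I
    t∉I t∈I = ¬genI (generated-mem t∈I)

  spans⇔generated : ∀ {X t} → Spans A X t ⇔ Generated X t
  spans⇔generated {X} {t} = mk⇔ to from
    where
    to : Spans A X t → Generated X t
    to (ρ , hasRank , hasRank′) with generated? X t
    ... | yes genX = genX
    ... | no ¬genX =
      ⊥-elim (rank-grows ¬genX hasRank (subst (λ Z → HasRank A Z ρ) (∪⁅⁆≡add X t) hasRank′))
    from : Generated X t → Spans A X t
    from genX with rank X
    ... | ρ , hasRank =
      ρ , hasRank , subst (λ Z → HasRank A Z ρ) (sym (∪⁅⁆≡add X t)) (rank-stable genX hasRank)

-- Deleting e: subsets of E avoiding e correspond to subsets of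
-- E ∖ {e} ≅ Fin n, via removeElt and insertion of e as a non-element.

punchIn-view : ∀ {n} (e i : Fin (suc n)) → i ≡ e ⊎ ∃ λ j → punchIn e j ≡ i
punchIn-view e i with i ≟ᶠ e
... | yes i≡e = inj₁ i≡e
... | no  i≢e = inj₂ (punchOut (i≢e ∘ sym) , punchIn-punchOut (i≢e ∘ sym))

removeElt-∈⁺ : ∀ {n} {p : Subset (suc n)} {e j} → punchIn e j ∈ p → j ∈ removeElt p e
removeElt-∈⁺ {p = p} {e} {j} i∈p =
  lookup⇒[]= j (removeElt p e) (trans (lookup∘tabulate _ j) ([]=⇒lookup i∈p))

removeElt-∈⁻ : ∀ {n} {p : Subset (suc n)} {e j} → j ∈ removeElt p e → punchIn e j ∈ p
removeElt-∈⁻ {p = p} {e} {j} j∈ =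
  lookup⇒[]= (punchIn e j) p (trans (sym (lookup∘tabulate _ j)) ([]=⇒lookup j∈))

removeElt-mono : ∀ {n} {p q : Subset (suc n)} {e} → p ⊆ q → removeElt p e ⊆ removeElt q e
removeElt-mono p⊆q = removeElt-∈⁺ ∘ p⊆q ∘ removeElt-∈⁻

removeElt-insertAt : ∀ {n} (p : Subset n) e → removeElt (insertAt p e false) e ≡ p
removeElt-insertAt p e = trans (tabulate-cong (insertAt-punchIn p e false)) (tabulate∘lookup p)

e∉insertAt : ∀ {n} (p : Subset n) e → e ∉ insertAt p e false
e∉insertAt p e e∈ with trans (sym ([]=⇒lookup e∈)) (insertAt-lookup p e false)
... | ()

Solution : ∀ {m n} → BinRep m n → (Fin n → ℕ) → Subset n → ℕ → Subset n → Set
Solution A w T k F = F ⊆ ∁ T × weight w F ≤ k × SpansAll A F T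

module Deletion {m n} (A : BinRep m (suc n)) (e : Fin (suc n)) where
  module M  = Span A
  module M∖e = Span (delete A e)

  colSum-delete : ∀ {Y} → e ∉ Y → ∀ r → M.colSum Y r ≡ M∖e.colSum (removeElt Y e) r
  colSum-delete {Y} e∉Y r = trans (M.colSum≡Σ∈ Y r)
    (trans (XorSum.Σ∈-avoiding {p = Y} (A r) (∉⇒false e∉Y)) (sym (M∖e.colSum≡Σ∈ (removeElt Y e) r)))

  generated-delete : ∀ {F} → e ∉ F → ∀ j →
                     M.Generated F (punchIn e j) ⇔ M∖e.Generated (removeElt F e) j
  generated-delete {F} e∉F j = mk⇔ to from
    where
    to : M.Generated F (punchIn e j) → M∖e.Generated (removeElt F e) j
    to (Y , Y⊆F , Y≗j) = removeElt Y e , removeElt-mono Y⊆F ,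
      λ r → trans (sym (colSum-delete (e∉F ∘ Y⊆F) r)) (Y≗j r)
    from : M∖e.Generated (removeElt F e) j → M.Generated F (punchIn e j)
    from (Y′ , Y′⊆ , Y′≗j) = insertAt Y′ e false , lifted⊆F , λ r →
      trans (colSum-delete (e∉insertAt Y′ e) r)
            (trans (cong (λ Z → M∖e.colSum Z r) (removeElt-insertAt Y′ e)) (Y′≗j r))
      where
      lifted⊆F : insertAt Y′ e false ⊆ F
      lifted⊆F {i} i∈ with punchIn-view e i
      ... | inj₁ refl        = ⊥-elim (e∉insertAt Y′ e i∈)
      ... | inj₂ (j′ , refl) =
        removeElt-∈⁻ (Y′⊆ (subst (j′ ∈_) (removeElt-insertAt Y′ e) (removeElt-∈⁺ i∈)))

  spans-delete : ∀ {F} → e ∉ F → ∀ j → Spans A F (punchIn e j) ⇔ Spans (delete A e) (removeElt F e) j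
  spans-delete e∉F j =
    ⇔-trans M.spans⇔generated (⇔-trans (generated-delete e∉F j) (⇔-sym M∖e.spans⇔generated))

  weight-delete : ∀ {F} (w : Fin (suc n) → ℕ) → e ∉ F →
                  weight w F ≡ weight (restrictW w e) (removeElt F e)
  weight-delete {F} w e∉F = trans (weight≡Σ∈ w F)
    (trans (NatSum.Σ∈-avoiding {p = F} w (∉⇒false e∉F)) (sym (weight≡Σ∈ (restrictW w e) (removeElt F e))))

  disjoint-delete : ∀ {F} T → e ∉ F → F ⊆ ∁ T ⇔ removeElt F e ⊆ ∁ (removeElt T e)
  disjoint-delete {F} T e∉F = mk⇔ to from
    where
    to : F ⊆ ∁ T → removeElt F e ⊆ ∁ (removeElt T e)
    to F⊆ j∈ = x∉p⇒x∈∁p λ j∈T′ → x∈∁p⇒x∉p (F⊆ (removeElt-∈⁻ j∈)) (removeElt-∈⁻ j∈T′)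
    from : removeElt F e ⊆ ∁ (removeElt T e) → F ⊆ ∁ T
    from F′⊆ {i} i∈F with punchIn-view e i
    ... | inj₁ refl       = ⊥-elim (e∉F i∈F)
    ... | inj₂ (j , refl) = x∉p⇒x∈∁p λ i∈T → x∈∁p⇒x∉p (F′⊆ (removeElt-∈⁺ i∈F)) (removeElt-∈⁺ i∈T)

  -- Spanning T in M is spanning T ∖ {e} in M - e: column e comes for free,
  -- being generated by the rest of a circuit C ⊆ T through e.
  spansAll-delete : ∀ {C F} T → Circuit A C → C ⊆ T → e ∈ C → e ∉ F →
                    SpansAll A F T ⇔ SpansAll (delete A e) (removeElt F e) (removeElt T e)
  spansAll-delete {C} {F} T circuit C⊆T e∈C e∉F = mk⇔ to from
    where
    to : SpansAll A F T → SpansAll (delete A e) (removeElt F e) (removeElt T e)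
    to spans {j} j∈T′ = Equivalence.to (spans-delete e∉F j) (spans (removeElt-∈⁻ j∈T′))
    from : SpansAll (delete A e) (removeElt F e) (removeElt T e) → SpansAll A F T
    from spans′ = spans
      where
      generates-T∖e : ∀ {t} → t ∈ T → t ≢ e → M.Generated F t
      generates-T∖e {t} t∈T t≢e with punchIn-view e t
      ... | inj₁ t≡e        = ⊥-elim (t≢e t≡e)
      ... | inj₂ (j , refl) = Equivalence.from (generated-delete e∉F j)
                                (Equivalence.to M∖e.spans⇔generated (spans′ (removeElt-∈⁺ t∈T)))
      generates-C∖e : ∀ {c} → c ∈ remove e C → M.Generated F c
      generates-C∖e c∈ = generates-T∖e (C⊆T (remove-⊆ c∈)) λ { refl → x∉remove c∈ }
      generates-T : ∀ {t} → t ∈ T → M.Generated F t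
      generates-T {t} t∈T with t ≟ᶠ e
      ... | yes refl = M.generated-trans generates-C∖e (M.circuit-generated circuit e∈C)
      ... | no  t≢e  = generates-T∖e t∈T t≢e
      spans : SpansAll A F T
      spans t∈T = Equivalence.from M.spans⇔generated (generates-T t∈T)

  solution-delete : ∀ {C F} w T k → Circuit A C → C ⊆ T → e ∈ C → e ∉ F →
                    Solution A w T k F ⇔ Solution (delete A e) (restrictW w e) (removeElt T e) k (removeElt F e)
  solution-delete {F = F} w T k circuit C⊆T e∈C e∉F =
    disjoint-delete T e∉F ×-⇔ weight≤k ×-⇔ spansAll-delete T circuit C⊆T e∈C e∉F
    where
    weight≤k : weight w F ≤ k ⇔ weight (restrictW w e) (removeElt F e) ≤ k
    weight≤k = mk⇔ (subst (_≤ k) (weight-delete w e∉F)) (subst (_≤ k) (sym (weight-delete w e∉F)))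

lemma1 : ∀ {m n} (A : BinRep m (suc n)) (w : Fin (suc n) → ℕ) (T : Subset (suc n)) (k : ℕ)
         → Regular A
         → (C : Subset (suc n)) → Circuit A C → C ⊆ T
         → (e : Fin (suc n)) → e ∈ C
         → SpaceCoverYes A w T k ⇔ SpaceCoverYes (delete A e) (restrictW w e) (removeElt T e) k
lemma1 A w T k _ C circuit C⊆T e e∈C = mk⇔ forward backward
  where
  open Deletion A e
  transfer : ∀ {F} → e ∉ F →
             Solution A w T k F ⇔ Solution (delete A e) (restrictW w e) (removeElt T e) k (removeElt F e)
  transfer = solution-delete w T k circuit C⊆T e∈C

  forward : SpaceCoverYes A w T k → SpaceCoverYes (delete A e) (restrictW w e) (removeElt T e) k
  forward (F , solution) = removeElt F e , Equivalence.to (transfer e∉F) solution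
    where
    e∉F : e ∉ F
    e∉F e∈F = x∈∁p⇒x∉p (proj₁ solution e∈F) (C⊆T e∈C)

  backward : SpaceCoverYes (delete A e) (restrictW w e) (removeElt T e) k → SpaceCoverYes A w T k
  backward (F′ , solution′) = insertAt F′ e false , Equivalence.from (transfer (e∉insertAt F′ e))
    (subst (Solution (delete A e) (restrictW w e) (removeElt T e) k) (sym (removeElt-insertAt F′ e)) solution′)
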